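{- Let $\mathbf{A}$ be a pp-atomic relational structure that is polylocal or has the property that every complete positive primitive type $\Psi$ over $\mathbf{A}$ is generated by $\Psi^{(0)}$. Then $\mathbf{A}$ is weakly polymorphism-homogeneous.
   Context: $\mathbf{A}$ is a structure over a relational signature $L$. A positive primitive (pp) formula is $\exists y_1\dots\exists y_k\,\psi$ with $\psi$ a conjunction of atoms; $\varphi(x_1,\dots,x_m)$ defines $\varphi^{\mathbf{A}}\subseteq A^m$. For $\varrho\subseteq A^m$, $\operatorname{Tpp}_{\mathbf{A}}(\varrho)$ is the set of pp formulae $\varphi(x_1,\dots,x_m)$ with $\varrho\subseteq\varphi^{\mathbf{A}}$; for a set $\Psi$ of such formulae (an $m$-ary pp type) $\Psi^{\mathbf{A}}=\bigcap_{\varphi\in\Psi}\varphi^{\mathbf{A}}$. A type is closed if $\Psi=\operatorname{Tpp}_{\mathbf{A}}(\Psi^{\mathbf{A}})$; a closed type is principal if $\Psi=\operatorname{Tpp}_{\mathbf{A}}(\psi^{\mathbf{A}})$ for some $\psi\in\Psi$; complete pp types are those of the form $\operatorname{Tpp}_{\mathbf{A}}(\tau)$ with $\tau\subseteq A^m$ finite. $\mathbf{A}$ is pp-atomic if all complete pp types are principal. $\Psi^{(k)}$ is the set of formulae of $\Psi$ logically equivalent to a pp formula $\exists x_{m+1}\dots\exists x_{m+k}\,\psi(x_1,\dots,x_{m+k})$ with $\psi$ a conjunction of atoms (so $\Psi^{(0)}$ consists of those equivalent to conjunctions of atoms); $\Psi$ is generated by $\Psi^{(k)}$ if $\operatorname{Tpp}_{\mathbf{A}}((\Psi^{(k)})^{\mathbf{A}})=\Psi$;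 $\operatorname{Tpp}^{(k)}_{\mathbf{A}}(\tau)=(\operatorname{Tpp}_{\mathbf{A}}(\tau))^{(k)}$. $\mathbf{A}$ is polylocal if for every $m$ and every $\sigma\subseteq A^m$: $\sigma$ is of the form $\Psi^{\mathbf{A}}$ iff for every finite $\tau\subseteq\sigma$ and $\bar b\in A^m$, $\operatorname{Tpp}^{(0)}_{\mathbf{A}}(\tau)\subseteq\operatorname{Tpp}^{(0)}_{\mathbf{A}}(\{\bar b\})$ implies $\bar b\in\sigma$. $\mathbf{A}$ is weakly polymorphism-homogeneous if for all $n\geq1$, every finite induced substructure $\mathbf{C}$ of the direct power $\mathbf{A}^n$, every induced substructure $\mathbf{B}$ of $\mathbf{C}$ and every homomorphism $h:\mathbf{B}\to\mathbf{A}$ there is a homomorphism $\mathbf{C}\to\mathbf{A}$ extending $h$. -}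

module Defs where

open import Level using (Level; 0ℓ; _⊔_) renaming (suc to lsuc)
open import Data.Nat using (ℕ; _+_; _≤_)
open import Data.Fin using (Fin)
open import Data.Vec using (Vec; lookup; _++_; map)
open import Data.List using (List)
open import Data.List.Relation.Unary.All using (All)
open import Data.List.Membership.Propositional using (_∈_)
open import Data.Product using (Σ; ∃; _×_; _,_)
open import Relation.Unary using (Pred; _⊆_; _≐_)
open import Relation.Binary.PropositionalEquality using (_≡_)
open import Function using (_∘_)
open import Function.Bundles using (_⇔_)

record Signature : Set₁ where
  field
    Sym : Set
    ar  : Sym → ℕ
open Signature public

record Structure (L : Signature) : Set₁ where
  field
    Carrier : Set
    rel     : (R : Sym L) → Pred (Vec Carrier (ar L R)) 0ℓ
open Structure public

data Atom (L : Signature) (n : ℕ) : Set where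
  relAt : (R : Sym L) → Vec (Fin n) (ar L R) → Atom L n
  eqAt  : Fin n → Fin n → Atom L n

-- A pp formula φ(x₁,…,xₘ) = ∃ y₁ … ∃ y_nex (conjunction of atoms) ;
-- variables 0..m-1 are the free x's, m..m+nex-1 the quantified y's.
record PP (L : Signature) (m : ℕ) : Set where
  constructor pp
  field
    nex   : ℕ
    atoms : List (Atom L (m + nex))
open PP public

module _ {L : Signature} where

  holds : (B : Structure L) {n : ℕ} → Vec (Carrier B) n → Atom L n → Set
  holds B v (relAt R xs) = rel B R (map (lookup v) xs)
  holds B v (eqAt i j)   = lookup v i ≡ lookup v j

  sem : (B : Structure L) {m : ℕ} → PP L m → Pred (Vec (Carrier B) m) 0ℓ
  sem B φ a = ∃ λ (b : Vec (Carrier B) (nex φ)) → All (holds B (a ++ b)) (atoms φ)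

  LogEquiv : {m : ℕ} → PP L m → PP L m → Set₁
  LogEquiv φ ψ = (B : Structure L) → sem B φ ≐ sem B ψ

  module _ (A : Structure L) where

    Tpp : {m : ℕ} {ℓ : Level} → Pred (Vec (Carrier A) m) ℓ → Pred (PP L m) ℓ
    Tpp ρ φ = ρ ⊆ sem A φ

    Realise : {m : ℕ} {ℓ : Level} → Pred (PP L m) ℓ → Pred (Vec (Carrier A) m) ℓ
    Realise Ψ a = ∀ {φ} → Ψ φ → sem A φ a

    Restrict : {m : ℕ} {ℓ : Level} → ℕ → Pred (PP L m) ℓ → Pred (PP L m) (ℓ ⊔ lsuc 0ℓ)
    Restrict k Ψ φ = Ψ φ × Σ (PP L _) (λ ψ → nex ψ ≡ k × LogEquiv φ ψ)

    GeneratedBy : {m : ℕ} {ℓ : Level} → ℕ → Pred (PP L m) ℓ → Set (ℓ ⊔ lsuc 0ℓ)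
    GeneratedBy k Ψ = Tpp (Realise (Restrict k Ψ)) ≐ Ψ

    Principal : {m : ℕ} {ℓ : Level} → Pred (PP L m) ℓ → Set ℓ
    Principal Ψ = Σ (PP L _) λ ψ → Ψ ψ × (Ψ ≐ Tpp (sem A ψ))

    CompleteType : {m : ℕ} → List (Vec (Carrier A) m) → Pred (PP L m) 0ℓ
    CompleteType τ = Tpp (_∈ τ)

    PPAtomic : Set
    PPAtomic = ∀ (m : ℕ) (τ : List (Vec (Carrier A) m)) → Principal (CompleteType τ)

    Tpp0 : {m : ℕ} {ℓ : Level} → Pred (Vec (Carrier A) m) ℓ → Pred (PP L m) (ℓ ⊔ lsuc 0ℓ)
    Tpp0 ρ = Restrict 0 (Tpp ρ)

    Polylocal : Set₁
    Polylocal = ∀ (m : ℕ) (σ : Pred (Vec (Carrier A) m) 0ℓ) →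
      (Σ (Pred (PP L m) 0ℓ) (λ Ψ → σ ≐ Realise Ψ))
      ⇔ (∀ (τ : List (Vec (Carrier A) m)) → (_∈ τ) ⊆ σ →
           ∀ (b : Vec (Carrier A) m) → Tpp0 (_∈ τ) ⊆ Tpp0 (_≡ b) → σ b)

    Injective' : {X Y : Set} → (X → Y) → Set
    Injective' f = ∀ {i j} → f i ≡ f j → i ≡ j

    -- h : D → A is a homomorphism from the induced substructure of A^n on
    -- the (finite) set of elements {c i} (given by an injective indexing c).
    IsHomFromPower : (n : ℕ) {p : ℕ} → (Fin p → Vec (Carrier A) n) → (Fin p → Carrier A) → Set
    IsHomFromPower n {p} c h =
      ∀ (R : Sym L) (r : Vec (Fin p) (ar L R)) →
        (∀ (t : Fin n) → rel A R (map (λ j → lookup (c j) t) r)) →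
        rel A R (map h r)

    WeaklyPolymorphismHomogeneous : Set
    WeaklyPolymorphismHomogeneous =
      ∀ (n : ℕ) → 1 ≤ n →
      ∀ (p : ℕ) (c : Fin p → Vec (Carrier A) n) → Injective' c →      -- C ⊆ A^n finite
      ∀ (q : ℕ) (ι : Fin q → Fin p) → Injective' ι →                 -- B ⊆ C
      ∀ (h : Fin q → Carrier A) → IsHomFromPower n (c ∘ ι) h →
      Σ (Fin p → Carrier A) λ g → IsHomFromPower n c g × (∀ i → g (ι i) ≡ h i)

-- Reading C column by column gives n tuples in A^p; by pp-atomicity their
-- complete pp type is generated by one formula ψ. Because h preserves atoms and
-- c is injective, h satisfies every quantifier-free formula true on the columns
-- of B, and either hypothesis upgrades this to the complete type of those
-- columns. That type contains ∃ȳ (ψ(ȳ) ∧ ⋀ᵢ xᵢ = y_{ι i}), so h extends to a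
-- tuple g ⊨ ψ. Then g satisfies the complete type of the columns of C, in
-- particular every atom holding in all of them: g is a homomorphism C → A.
module Submission where

open import Defs
open import Data.Sum using (_⊎_; [_,_]′)
open import Data.List using (List; []; _∷_; allFin) renaming (map to mapL; _++_ to _++L_; tabulate to tabulateL)
open import Data.Vec using (Vec; []; _∷_; lookup; tabulate; _++_; map; splitAt)
open import Data.Vec.Properties using (map-cong; map-∘; lookup-++ˡ; lookup-++ʳ; lookup∘tabulate; tabulate∘lookup; tabulate-cong)
open import Data.Nat using (ℕ; _+_)
open import Data.Nat.Properties using (+-identityʳ)
open import Data.Fin as Fin using (Fin; _↑ˡ_; _↑ʳ_)
open import Data.Product using (∃; _×_; _,_; proj₁; proj₂)
open import Data.List.Membership.Propositional using (_∈_)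
open import Data.List.Membership.Propositional.Properties using (∈-map⁺; ∈-map⁻; ∈-allFin)
open import Data.List.Relation.Unary.All as All using (All; []; _∷_)
open import Data.List.Relation.Unary.All.Properties using (++⁺; ++⁻; map⁺; map⁻; tabulate⁺; tabulate⁻)
open import Level using (Level)
open import Relation.Unary using (Pred; _⊆_)
open import Relation.Unary.Properties using (≐-refl)
open import Relation.Binary.PropositionalEquality using (_≡_; _≗_; refl; sym; trans; cong; subst; module ≡-Reasoning)
open import Function using (_∘_; _⇔_; mk⇔; Equivalence)

open Equivalence using (to; from)

-- Quantifier-free pp formulae have their variables in Fin (m + 0), which is not
-- definitionally Fin m.
unpad : ∀ {m} → Fin (m + 0) → Fin m
unpad {m} = Fin.cast (+-identityʳ m)

module _ {a : Level} {X : Set a} where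

  lookup-ext : ∀ {m} {v w : Vec X m} → lookup v ≗ lookup w → v ≡ w
  lookup-ext {v = v} {w} v≗w = trans (sym (tabulate∘lookup v)) (trans (tabulate-cong v≗w) (tabulate∘lookup w))

  map-lookup-tabulate : ∀ {m s} (f : Fin m → X) (r : Vec (Fin m) s) → map (lookup (tabulate f)) r ≡ map f r
  map-lookup-tabulate f = map-cong (lookup∘tabulate f)

  lookup-++-[] : ∀ {m} (v : Vec X m) → lookup (v ++ []) ≗ lookup v ∘ unpad
  lookup-++-[] (x ∷ v) Fin.zero    = refl
  lookup-++-[] (x ∷ v) (Fin.suc i) = lookup-++-[] v i

module _ {L : Signature} where

  renAtom : ∀ {m k} → (Fin m → Fin k) → Atom L m → Atom L k
  renAtom ρ (relAt R xs) = relAt R (map ρ xs)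
  renAtom ρ (eqAt i j)   = eqAt (ρ i) (ρ j)

  atomicPP : ∀ {m} → Atom L m → PP L m
  atomicPP α = pp 0 (renAtom (_↑ˡ 0) α ∷ [])

  -- ∃ȳ (ψ(ȳ) ∧ ⋀ᵢ xᵢ = y_{ι i}), the existential projection of ψ along ι
  project : ∀ {p q} → (Fin q → Fin p) → PP L p → PP L q
  project {p} {q} ι ψ = pp (p + nex ψ) (mapL (renAtom (q ↑ʳ_)) (atoms ψ) ++L tabulateL identify)
    where
      identify : Fin q → Atom L (q + (p + nex ψ))
      identify i = eqAt (i ↑ˡ (p + nex ψ)) (q ↑ʳ (ι i ↑ˡ nex ψ))

module _ {L : Signature} (A : Structure L) where

  private
    X : Set
    X = Carrier A

  holds-renAtom : ∀ {m k} {ρ : Fin m → Fin k} {v : Vec X k} {w : Vec X m} →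
    lookup w ≗ lookup v ∘ ρ → ∀ α → holds A v (renAtom ρ α) ⇔ holds A w α
  holds-renAtom {ρ = ρ} {v} {w} w≗vρ (relAt R xs) = mk⇔ (subst (rel A R) v∘ρ≡w) (subst (rel A R) (sym v∘ρ≡w))
    where
      v∘ρ≡w : map (lookup v) (map ρ xs) ≡ map (lookup w) xs
      v∘ρ≡w = trans (sym (map-∘ (lookup v) ρ xs)) (map-cong (sym ∘ w≗vρ) xs)
  holds-renAtom w≗vρ (eqAt i j) =
    mk⇔ (λ e → trans (w≗vρ i) (trans e (sym (w≗vρ j))))
        (λ e → trans (sym (w≗vρ i)) (trans e (w≗vρ j)))

  sem-atomicPP : ∀ {m} (α : Atom L m) {v : Vec X m} → sem A (atomicPP α) v ⇔ holds A v α
  sem-atomicPP α {v} = mk⇔ (λ { ([] , α⊨ ∷ []) → to padding α⊨ }) (λ α⊨ → [] , from padding α⊨ ∷ [])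
    where
      padding : holds A (v ++ []) (renAtom (_↑ˡ 0) α) ⇔ holds A v α
      padding = holds-renAtom (sym ∘ lookup-++ˡ v []) α

  sem-quantifierFree : ∀ {m} {as : List (Atom L (m + 0))} {v : Vec X m} →
    sem A (pp 0 as) v ⇔ All (λ α → holds A v (renAtom unpad α)) as
  sem-quantifierFree {v = v} =
    mk⇔ (λ { ([] , as⊨) → All.map (λ {α} → from (unpadding α)) as⊨ })
        (λ as⊨ → [] , All.map (λ {α} → to (unpadding α)) as⊨)
    where
      unpadding : ∀ α → holds A v (renAtom unpad α) ⇔ holds A (v ++ []) α
      unpadding = holds-renAtom (lookup-++-[] v)

  sem-project : ∀ {p q} (ι : Fin q → Fin p) (ψ : PP L p) {u : Vec X q} →
    sem A (project ι ψ) u ⇔ (∃ λ v → sem A ψ v × lookup u ≗ lookup v ∘ ι)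
  sem-project {p} {q} ι ψ {u} = mk⇔ split join
    where
      k : ℕ
      k = nex ψ

      shifted : ∀ (vw : Vec X (p + k)) → lookup vw ≗ lookup (u ++ vw) ∘ (q ↑ʳ_)
      shifted vw = sym ∘ lookup-++ʳ u vw

      split : sem A (project ι ψ) u → ∃ λ v → sem A ψ v × lookup u ≗ lookup v ∘ ι
      split (vw , all⊨) with splitAt p vw
      ... | v , w , refl with ++⁻ (mapL (renAtom (q ↑ʳ_)) (atoms ψ)) all⊨
      ... | renamed⊨ , identified⊨ =
        v , (w , All.map (λ {α} → to (holds-renAtom (shifted (v ++ w)) α)) (map⁻ renamed⊨)) , u≗vι
        where
          u≗vι : lookup u ≗ lookup v ∘ ι
          u≗vι i = begin
            lookup u i                                ≡⟨ lookup-++ˡ u (v ++ w) i ⟨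
            lookup (u ++ (v ++ w)) (i ↑ˡ (p + k))      ≡⟨ tabulate⁻ identified⊨ i ⟩
            lookup (u ++ (v ++ w)) (q ↑ʳ (ι i ↑ˡ k))   ≡⟨ lookup-++ʳ u (v ++ w) (ι i ↑ˡ k) ⟩
            lookup (v ++ w) (ι i ↑ˡ k)                ≡⟨ lookup-++ˡ v w (ι i) ⟩
            lookup v (ι i)                            ∎
            where open ≡-Reasoning

      join : (∃ λ v → sem A ψ v × lookup u ≗ lookup v ∘ ι) → sem A (project ι ψ) u
      join (v , (w , ψ⊨) , u≗vι) =
        v ++ w , ++⁺ (map⁺ (All.map (λ {α} → from (holds-renAtom (shifted (v ++ w)) α)) ψ⊨)) (tabulate⁺ identified)
        where
          identified : ∀ i → lookup (u ++ (v ++ w)) (i ↑ˡ (p + k)) ≡ lookup (u ++ (v ++ w)) (q ↑ʳ (ι i ↑ˡ k))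
          identified i = begin
            lookup (u ++ (v ++ w)) (i ↑ˡ (p + k))      ≡⟨ lookup-++ˡ u (v ++ w) i ⟩
            lookup u i                                ≡⟨ u≗vι i ⟩
            lookup v (ι i)                            ≡⟨ lookup-++ˡ v w (ι i) ⟨
            lookup (v ++ w) (ι i ↑ˡ k)                ≡⟨ lookup-++ʳ u (v ++ w) (ι i ↑ˡ k) ⟨
            lookup (u ++ (v ++ w)) (q ↑ʳ (ι i ↑ˡ k))   ∎
            where open ≡-Reasoning

  -- The elements c₁,…,c_p of a subset of Aⁿ form a p-tuple in the power Aⁿ;
  -- its pp type is the complete type of its n columns in A^p.
  column : ∀ {n p} → (Fin p → Vec X n) → Fin n → Vec X p
  column c t = tabulate (λ j → lookup (c j) t)

  columns : ∀ {n p} → (Fin p → Vec X n) → List (Vec X p)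
  columns {n} c = mapL (column c) (allFin n)

  column∈columns : ∀ {n p} (c : Fin p → Vec X n) t → column c t ∈ columns c
  column∈columns c t = ∈-map⁺ (column c) (∈-allFin t)

  columns-⊆ : ∀ {n p ℓ} (c : Fin p → Vec X n) {P : Pred (Vec X p) ℓ} →
    (∀ t → P (column c t)) → (_∈ columns c) ⊆ P
  columns-⊆ c P-columns x∈ with ∈-map⁻ (column c) x∈
  ... | t , _ , refl = P-columns t

  hom⇒holds : ∀ {n q} {c : Fin q → Vec X n} {h : Fin q → X} → Injective' A c → IsHomFromPower A n c h →
    ∀ α → (∀ t → holds A (column c t) α) → holds A (tabulate h) α
  hom⇒holds {h = h} _ h-hom (relAt R r) α⊨ =
    subst (rel A R) (sym (map-lookup-tabulate h r))
      (h-hom R r (λ t → subst (rel A R) (map-lookup-tabulate _ r) (α⊨ t)))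
  hom⇒holds {c = c} {h} c-inj h-hom (eqAt i j) α⊨ =
    trans (lookup∘tabulate h i) (trans (cong h (c-inj cᵢ≡cⱼ)) (sym (lookup∘tabulate h j)))
    where
      cᵢ≡cⱼ : c i ≡ c j
      cᵢ≡cⱼ = lookup-ext λ t →
        trans (sym (lookup∘tabulate (λ j → lookup (c j) t) i)) (trans (α⊨ t) (lookup∘tabulate _ j))

  hom⇒realises-Tpp0 : ∀ {n q} {c : Fin q → Vec X n} {h : Fin q → X} → Injective' A c → IsHomFromPower A n c h →
    Realise A (Tpp0 A (_∈ columns c)) (tabulate h)
  hom⇒realises-Tpp0 {c = c} {h} c-inj h-hom (φ∈ , ψ , nexψ≡0 , φ≡ψ) =
    proj₂ (φ≡ψ A) (quantifierFree ψ nexψ≡0 (proj₁ (φ≡ψ A) ∘ φ∈))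
    where
      quantifierFree : ∀ ψ → nex ψ ≡ 0 → (_∈ columns c) ⊆ sem A ψ → sem A ψ (tabulate h)
      quantifierFree (pp .0 as) refl columns⊨ = from sem-quantifierFree (All.tabulate λ {α} α∈ →
        hom⇒holds {c = c} c-inj h-hom (renAtom unpad α)
          (λ t → All.lookup (to sem-quantifierFree (columns⊨ (column∈columns c t))) α∈))

  realises-Tpp⇒hom : ∀ {n p} {c : Fin p → Vec X n} {v : Vec X p} →
    Realise A (CompleteType A (columns c)) v → IsHomFromPower A n c (lookup v)
  realises-Tpp⇒hom {c = c} v⊨ R r columns⊨R = to (sem-atomicPP (relAt R r)) (v⊨ R∈)
    where
      R∈ : CompleteType A (columns c) (atomicPP (relAt R r))
      R∈ = columns-⊆ c {sem A (atomicPP (relAt R r))} λ t →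
        from (sem-atomicPP (relAt R r)) (subst (rel A R) (sym (map-lookup-tabulate _ r)) (columns⊨R t))

  project-∈-Tpp : ∀ {n p q} (c : Fin p → Vec X n) (ι : Fin q → Fin p) {ψ : PP L p} →
    CompleteType A (columns c) ψ → CompleteType A (columns (c ∘ ι)) (project ι ψ)
  project-∈-Tpp c ι {ψ} ψ∈ = columns-⊆ (c ∘ ι) {sem A (project ι ψ)} λ t →
    from (sem-project ι ψ) (column c t , ψ∈ (column∈columns c t) , λ i →
      trans (lookup∘tabulate _ i) (sym (lookup∘tabulate (λ j → lookup (c j) t) (ι i))))

  Tpp0DeterminesTpp : Set₁
  Tpp0DeterminesTpp = ∀ m (τ : List (Vec X m)) → Realise A (Tpp0 A (_∈ τ)) ⊆ Realise A (CompleteType A τ)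

  polylocal⇒Tpp0DeterminesTpp : Polylocal A → Tpp0DeterminesTpp
  polylocal⇒Tpp0DeterminesTpp polylocal m τ {b} b⊨ =
    to (polylocal m (Realise A (CompleteType A τ))) (CompleteType A τ , ≐-refl) τ (λ x∈ φ∈ → φ∈ x∈) b Tpp0⊆
    where
      Tpp0⊆ : Tpp0 A (_∈ τ) ⊆ Tpp0 A (_≡ b)
      Tpp0⊆ (φ∈ , φ-qf) = (λ { refl → b⊨ (φ∈ , φ-qf) }) , φ-qf

  generatedBy0⇒Tpp0DeterminesTpp : (∀ m (τ : List (Vec X m)) → GeneratedBy A 0 (CompleteType A τ)) → Tpp0DeterminesTpp
  generatedBy0⇒Tpp0DeterminesTpp generated m τ b⊨ φ∈ = proj₂ (generated m τ) φ∈ b⊨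

mainTheorem16 : {L : Signature} (A : Structure L) → PPAtomic A →
    (Polylocal A ⊎ (∀ (m : ℕ) (τ : List (Vec (Carrier A) m)) → GeneratedBy A 0 (CompleteType A τ))) →
    WeaklyPolymorphismHomogeneous A
mainTheorem16 A atomic condition n _ p c c-inj q ι ι-inj h h-hom
  with atomic p (columns A c)
... | ψ , ψ∈ , ψ-generates
  with to (sem-project A ι ψ) (h⊨ (project-∈-Tpp A c ι ψ∈))
  where
    h⊨ : Realise A (CompleteType A (columns A (c ∘ ι))) (tabulate h)
    h⊨ = [ polylocal⇒Tpp0DeterminesTpp A , generatedBy0⇒Tpp0DeterminesTpp A ]′ condition q _
           (hom⇒realises-Tpp0 A {c = c ∘ ι} (ι-inj ∘ c-inj) h-hom)
... | g , g⊨ψ , h≗gι =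
  lookup g , realises-Tpp⇒hom A {c = c} (λ φ∈ → proj₁ ψ-generates φ∈ g⊨ψ) , λ i → trans (sym (h≗gι i)) (lookup∘tabulate h i)
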